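{- Let $\sigma$ be a bivincular pattern of length $k$ whose underlying permutation $\sigma[1]\cdots\sigma[k]$ avoids $213$ and $231$, and let $i,j$ be positions such that the values $\sigma[i]$ and $\sigma[j]$ are overlined together in the top row (so $\sigma[j]=\sigma[i]+1$). If $\sigma[i]$ and $\sigma[j]$ are both ascent elements, then $i<j$ and $\sigma[l]$ is a descent element for every $i<l<j$. If $\sigma[i]$ and $\sigma[j]$ are both descent elements, then $j<i$ and $\sigma[l]$ is an ascent element for every $j<l<i$.
   Context: For a permutation $\sigma$ of length $k$ and $1\le r<k$, $\sigma[r]$ is an ascent element if $\sigma[r]<\sigma[r+1]$ and a descent element if $\sigma[r]>\sigma[r+1]$. A bivincular pattern of length $k$ is a permutation $\sigma\in S_k$ written in two-line notation (top row $12\cdots k$, bottom row $\sigma[1]\cdots\sigma[k]$) together with: underlined blocks of consecutive bottom-row entries (their matches must be at consecutive positions), optional markers requiring the first (resp. last) entry to be matched to the leftmost (resp. rightmost) entry of the text, overlined blocks of consecutive top-row values $\overline{a\,(a+1)\cdots b}$ (the matches of the entries with these values must be consecutive in value), and optional markers requiring value $1$ (resp. $k$) to be matched to the minimum (resp. maximum) of the text. Writing $\overline{\sigma[i]\sigma[j]}$ means the values $\sigma[i]$ and $\sigma[j]=\sigma[i]+1$ lie in a common overlined block. -}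

module Defs where

open import Data.Nat using (ℕ; suc)
open import Data.Fin using (Fin; toℕ; _<_; _≤_)
open import Data.Fin.Permutation using (Permutation′; _⟨$⟩ʳ_)
open import Data.Bool using (Bool)
open import Data.List using (List)
open import Data.List.Membership.Propositional using (_∈_)
open import Data.Product using (_×_; _,_; ∃; ∃-syntax)
open import Relation.Binary.PropositionalEquality using (_≡_)
open import Relation.Nullary using (¬_)

-- Positions and values are 0-based elements of Fin k
-- (paper's position r / value v correspond to Fin element r-1 / v-1).

record Bivincular (k : ℕ) : Set where
  field
    perm       : Permutation′ k
    underlined : List (Fin k × Fin k)      -- blocks of consecutive positions [a,b]
    startMark  : Bool                      -- first entry matched to leftmost of text
    endMark    : Bool                      -- last entry matched to rightmost of text
    overlined  : List (Fin k × Fin k)      -- blocks of consecutive values [a,b] (top row)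
    minMark    : Bool                      -- value 1 matched to min of text
    maxMark    : Bool                      -- value k matched to max of text

app : ∀ {k} → Permutation′ k → Fin k → Fin k
app σ r = σ ⟨$⟩ʳ r

Ascent : ∀ {k} → Permutation′ k → Fin k → Set
Ascent σ r = ∃[ r' ] (toℕ r' ≡ suc (toℕ r) × app σ r < app σ r')

Descent : ∀ {k} → Permutation′ k → Fin k → Set
Descent σ r = ∃[ r' ] (toℕ r' ≡ suc (toℕ r) × app σ r' < app σ r)

Contains213 : ∀ {k} → Permutation′ k → Set
Contains213 σ = ∃[ a ] ∃[ b ] ∃[ c ]
  (a < b × b < c × app σ b < app σ a × app σ a < app σ c)

Contains231 : ∀ {k} → Permutation′ k → Set
Contains231 σ = ∃[ a ] ∃[ b ] ∃[ c ]
  (a < b × b < c × app σ c < app σ a × app σ a < app σ b)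

OverlinedTogether : ∀ {k} → Bivincular k → Fin k → Fin k → Set
OverlinedTogether {k} P i j =
  toℕ (app σ j) ≡ suc (toℕ (app σ i)) ×
  ∃[ blk ] (blk ∈ Bivincular.overlined P ×
            Data.Product.proj₁ blk ≤ app σ i × app σ j ≤ Data.Product.proj₂ blk)
  where σ = Bivincular.perm P

-- Avoiding 231 forces every ascent element to be smaller than all later
-- entries, and avoiding 213 forces every descent element to be larger than
-- all later entries. Two ascent elements with consecutive values therefore
-- appear from left to right in order of value, and any ascent element between
-- them would need a value strictly between σ[i] and σ[i]+1; dually for descents.
module Submission where

open import Defs
open import Data.Nat using (ℕ)
open import Data.Fin using (Fin; _<_)
open import Data.Product using (_×_)
open import Relation.Nullary using (¬_)

import Data.Nat as ℕ
import Data.Nat.Properties as ℕ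
open import Data.Fin using (toℕ; fromℕ<; _≤_)
open import Data.Fin.Properties using (<-cmp; <-asym; <-irrefl; <⇒≢; toℕ<n; toℕ-fromℕ<)
open import Data.Fin.Permutation using (Permutation′)
open import Data.Product using (_,_)
open import Data.Sum using (_⊎_; inj₁; inj₂)
open import Function.Bundles using (Injection)
open import Function.Properties.Inverse using (↔⇒↣)
open import Relation.Binary using (tri<; tri≈; tri>)
open import Relation.Binary.PropositionalEquality using (_≡_; _≢_; refl; sym; subst)
open import Relation.Nullary using (contradiction)

successor-≤ : ∀ {k} {r r′ s : Fin k} → toℕ r′ ≡ ℕ.suc (toℕ r) → r < s → r′ ≤ s
successor-≤ {s = s} r′≡1+r r<s = subst (ℕ._≤ toℕ s) (sym r′≡1+r) r<s

<-suc-toℕ : ∀ {k} {a b : Fin k} → toℕ b ≡ ℕ.suc (toℕ a) → a < b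
<-suc-toℕ {a = a} b≡1+a = subst (ℕ.suc (toℕ a) ℕ.≤_) (sym b≡1+a) ℕ.≤-refl

no-Fin-between-suc : ∀ {k} {a b c : Fin k} → toℕ c ≡ ℕ.suc (toℕ a) → a < b → ¬ b < c
no-Fin-between-suc {a = a} {b} c≡1+a a<b b<c =
  ℕ.<⇒≱ a<b (ℕ.m<1+n⇒m≤n (subst (toℕ b ℕ.<_) c≡1+a b<c))

module _ {k} (σ : Permutation′ k) where

  app-injective : ∀ {a b} → app σ a ≡ app σ b → a ≡ b
  app-injective = Injection.injective (↔⇒↣ σ)

  app-<⊎> : ∀ {a b} → a ≢ b → app σ a < app σ b ⊎ app σ b < app σ a
  app-<⊎> {a} {b} a≢b with <-cmp (app σ a) (app σ b)
  ... | tri< σa<σb _ _ = inj₁ σa<σb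
  ... | tri≈ _ σa≡σb _ = contradiction (app-injective σa≡σb) a≢b
  ... | tri> _ _ σb<σa = inj₂ σb<σa

  successor⇒ascent⊎descent : ∀ {r r′} → toℕ r′ ≡ ℕ.suc (toℕ r) → Ascent σ r ⊎ Descent σ r
  successor⇒ascent⊎descent {r} {r′} r′≡1+r with app-<⊎> (<⇒≢ (<-suc-toℕ r′≡1+r))
  ... | inj₁ σr<σr′ = inj₁ (r′ , r′≡1+r , σr<σr′)
  ... | inj₂ σr′<σr = inj₂ (r′ , r′≡1+r , σr′<σr)

  ascent⊎descent : ∀ {r s} → r < s → Ascent σ r ⊎ Descent σ r
  ascent⊎descent {r} {s} r<s = successor⇒ascent⊎descent (toℕ-fromℕ< 1+r<k)
    where
    1+r<k : ℕ.suc (toℕ r) ℕ.< k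
    1+r<k = ℕ.≤-<-trans r<s (toℕ<n s)

  ascent⇒<-later : ¬ Contains231 σ → ∀ {r s} → Ascent σ r → r < s → app σ r < app σ s
  ascent⇒<-later no231 {r} {s} (r′ , r′≡1+r , σr<σr′) r<s with <-cmp r′ s
  ... | tri≈ _ refl _ = σr<σr′
  ... | tri> _ _ s<r′ = contradiction s<r′ (ℕ.≤⇒≯ (successor-≤ r′≡1+r r<s))
  ... | tri< r′<s _ _ with app-<⊎> (<⇒≢ r<s)
  ...   | inj₁ σr<σs = σr<σs
  ...   | inj₂ σs<σr =
    contradiction (r , r′ , s , <-suc-toℕ r′≡1+r , r′<s , σs<σr , σr<σr′) no231

  descent⇒>-later : ¬ Contains213 σ → ∀ {r s} → Descent σ r → r < s → app σ s < app σ r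
  descent⇒>-later no213 {r} {s} (r′ , r′≡1+r , σr′<σr) r<s with <-cmp r′ s
  ... | tri≈ _ refl _ = σr′<σr
  ... | tri> _ _ s<r′ = contradiction s<r′ (ℕ.≤⇒≯ (successor-≤ r′≡1+r r<s))
  ... | tri< r′<s _ _ with app-<⊎> (<⇒≢ r<s)
  ...   | inj₂ σs<σr = σs<σr
  ...   | inj₁ σr<σs =
    contradiction (r , r′ , s , <-suc-toℕ r′≡1+r , r′<s , σr′<σr , σr<σs) no213

  ascents-at-consecutive-values : ¬ Contains231 σ → ∀ {i j} →
    toℕ (app σ j) ≡ ℕ.suc (toℕ (app σ i)) → Ascent σ i → Ascent σ j →
    i < j × (∀ l → i < l → l < j → Descent σ l)
  ascents-at-consecutive-values no231 {i} {j} σj≡1+σi ascᵢ ascⱼ = i<j , between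
    where
    σi<σj : app σ i < app σ j
    σi<σj = <-suc-toℕ σj≡1+σi

    i<j : i < j
    i<j with <-cmp i j
    ... | tri< i<j _ _ = i<j
    ... | tri≈ _ refl _ = contradiction σi<σj (<-irrefl refl)
    ... | tri> _ _ j<i = contradiction (ascent⇒<-later no231 ascⱼ j<i) (<-asym σi<σj)

    between : ∀ l → i < l → l < j → Descent σ l
    between l i<l l<j with ascent⊎descent l<j
    ... | inj₂ descₗ = descₗ
    ... | inj₁ ascₗ = contradiction (ascent⇒<-later no231 ascₗ l<j)
                        (no-Fin-between-suc σj≡1+σi (ascent⇒<-later no231 ascᵢ i<l))

  descents-at-consecutive-values : ¬ Contains213 σ → ∀ {i j} →
    toℕ (app σ j) ≡ ℕ.suc (toℕ (app σ i)) → Descent σ i → Descent σ j →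
    j < i × (∀ l → j < l → l < i → Ascent σ l)
  descents-at-consecutive-values no213 {i} {j} σj≡1+σi descᵢ descⱼ = j<i , between
    where
    σi<σj : app σ i < app σ j
    σi<σj = <-suc-toℕ σj≡1+σi

    j<i : j < i
    j<i with <-cmp i j
    ... | tri> _ _ j<i = j<i
    ... | tri≈ _ refl _ = contradiction σi<σj (<-irrefl refl)
    ... | tri< i<j _ _ = contradiction (descent⇒>-later no213 descᵢ i<j) (<-asym σi<σj)

    between : ∀ l → j < l → l < i → Ascent σ l
    between l j<l l<i with ascent⊎descent l<i
    ... | inj₁ ascₗ = ascₗ
    ... | inj₂ descₗ = contradiction (descent⇒>-later no213 descⱼ j<l)
                         (no-Fin-between-suc σj≡1+σi (descent⇒>-later no213 descₗ l<i))

lemma4 : ∀ {k} (P : Bivincular k) (i j : Fin k) →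
    ¬ Contains213 (Bivincular.perm P) → ¬ Contains231 (Bivincular.perm P) →
    OverlinedTogether P i j →
    ((Ascent (Bivincular.perm P) i → Ascent (Bivincular.perm P) j →
        i < j × (∀ l → i < l → l < j → Descent (Bivincular.perm P) l))
     × (Descent (Bivincular.perm P) i → Descent (Bivincular.perm P) j →
        j < i × (∀ l → j < l → l < i → Ascent (Bivincular.perm P) l)))
lemma4 P i j no213 no231 (σj≡1+σi , _) =
  ascents-at-consecutive-values σ no231 σj≡1+σi ,
  descents-at-consecutive-values σ no213 σj≡1+σi
  where
  σ = Bivincular.perm P
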